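{- Suppose that $n=pq$ is odd, where $p,q>1$ are integers. Then there is a transitive avoidance game on $[n]=\{1,\dots,n\}$ that is a Player I win.
   Context: An avoidance game consists of a finite set $X$ (the board) and a family $\mathcal{L}$ of subsets of $X$ (the lines). Two players, Player I and Player II, alternately claim previously unclaimed points of $X$, Player I moving first. The first player to have claimed all points of some line loses; if all points have been claimed and neither player has completed a line, the game is a draw. The game is transitive if its automorphism group (the group of permutations of $X$ mapping $\mathcal{L}$ onto $\mathcal{L}$) acts transitively on $X$. The game is a Player I win if Player I has a strategy guaranteeing that Player II loses. -}

module Defs where

open import Data.Nat using (ℕ)
open import Data.Fin using (Fin)
open import Data.Fin.Subset using (Subset; _∈_; _∉_; _⊆_; _∪_; ⁅_⁆; ⊥)
open import Data.Fin.Permutation using (Permutation′; _⟨$⟩ʳ_; _⟨$⟩ˡ_)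
open import Data.Vec using (tabulate; lookup)
open import Data.List using (List)
open import Data.List.Relation.Unary.Any using (Any)
import Data.List.Membership.Propositional as LM
open import Data.Product using (Σ; ∃; _×_)
open import Data.Sum using (_⊎_)
open import Relation.Nullary using (¬_)
open import Relation.Binary.PropositionalEquality using (_≡_)

-- An avoidance game on the board [n] = Fin n: a family of lines,
-- each line a subset of the board.
Lines : ℕ → Set
Lines n = List (Subset n)

Completes : ∀ {n} → Lines n → Subset n → Set
Completes L S = Any (λ ℓ → ℓ ⊆ S) L

image : ∀ {n} → Permutation′ n → Subset n → Subset n
image σ S = tabulate (λ i → lookup S (σ ⟨$⟩ˡ i))

IsAutomorphism : ∀ {n} → Lines n → Permutation′ n → Set
IsAutomorphism L σ =
  (∀ ℓ → ℓ LM.∈ L → image σ ℓ LM.∈ L) ×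
  (∀ ℓ → ℓ LM.∈ L → Σ (Subset _) λ ℓ′ → ℓ′ LM.∈ L × image σ ℓ′ ≡ ℓ)

IsTransitive : ∀ {n} → Lines n → Set
IsTransitive {n} L =
  ∀ (x y : Fin n) → Σ (Permutation′ n) λ σ → IsAutomorphism L σ × σ ⟨$⟩ʳ x ≡ y

-- Player I can force a win (Player II loses) from a position in which
-- Player I has claimed A and Player II has claimed B.
-- IWinOnI : Player I to move;  IWinOnII : Player II to move.
-- A draw (board full, no line completed) is not a win.
module _ {n : ℕ} (L : Lines n) where
  data IWinOnI (A B : Subset n) : Set
  data IWinOnII (A B : Subset n) : Set

  data IWinOnI A B where
    move : (x : Fin n) → x ∉ A → x ∉ B →
           ¬ Completes L (A ∪ ⁅ x ⁆) →
           IWinOnII (A ∪ ⁅ x ⁆) B →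
           IWinOnI A B

  data IWinOnII A B where
    respond : (Σ (Fin n) λ y → y ∉ A × y ∉ B) →
              (∀ (x : Fin n) → x ∉ A → x ∉ B →
                 Completes L (B ∪ ⁅ x ⁆) ⊎ IWinOnI A (B ∪ ⁅ x ⁆)) →
              IWinOnII A B

PlayerIWin : ∀ {n} → Lines n → Set
PlayerIWin L = IWinOnI L ⊥ ⊥

module Submission where

-- The lines are the p rows and all transversals (one point
-- in every row), so a player loses by filling a row or by meeting every row.
-- Permuting rows and columns independently preserves the lines, which gives
-- transitivity.
--
-- Player I's strategy uses that p and q are odd.  Let π be the reflection
-- of the rows; its only fixed row is the middle row z.  Player I opens in z
-- and mirrors: a move of II in row t is answered in row π t.  Because q is
-- odd I never fills z, and I meets every row only if II meets every row but
-- z.  At that moment II can never touch z again, and I switches to a race: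
-- he avoids row π k (k being the row II entered last), plays in k while it
-- has room and otherwise in z, keeping his count in z at most II's count in
-- π k; every other move is still mirrored.

open import Defs
open import Data.Nat using (ℕ; zero; suc; _+_; _*_; _∸_; _≤_; _<_; z≤n; s≤s; _<?_)
open import Data.Nat.Properties hiding (_≟_)
open import Data.Nat.Divisibility using (_∣_; divides; ∣-trans; m∣m*n; n∣m*n)
open import Data.Bool using (Bool; true; false; _∨_)
open import Data.Bool.Properties using (∨-identityʳ; ∨-zeroʳ)
open import Data.Fin using (Fin; zero; suc; _≟_; toℕ; fromℕ<; opposite; combine; remQuot)
open import Data.Fin.Properties using (any?; all?; ¬∀⟶∃¬; toℕ-injective; toℕ-fromℕ<; opposite-prop; opposite-involutive; remQuot-combine; combine-remQuot; toℕ<n) renaming (suc-injective to Fin-suc-injective)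
open import Data.Fin.Subset using (Subset; _∈_; _∉_; _⊆_; _∪_; ⁅_⁆; ⊥)
open import Data.Fin.Subset.Properties using (x∈⁅x⁆; x≢y⇒x∉⁅y⁆; ∉⊥)
open import Data.Fin.Permutation using (Permutation′; permutation; transpose; _⟨$⟩ʳ_; _⟨$⟩ˡ_; inverseˡ; inverseʳ)
open import Data.Vec using (Vec; []; _∷_; lookup; tabulate)
open import Data.Vec.Properties using (lookup∘tabulate; []=⇒lookup; lookup⇒[]=; lookup-zipWith; tabulate-cong; tabulate∘lookup)
open import Data.List using (List; map; _++_; allFin; cartesianProductWith) renaming ([] to []ₗ; _∷_ to _∷ₗ_)
open import Data.List.Relation.Unary.Any using (here)
open import Data.List.Membership.Propositional using (find; lose) renaming (_∈_ to _∈ₗ_)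
open import Data.List.Membership.Propositional.Properties using (∈-map⁺; ∈-map⁻; ∈-++⁺ˡ; ∈-++⁺ʳ; ∈-++⁻; ∈-allFin; ∈-cartesianProductWith⁺)
open import Data.Product using (Σ; ∃; _×_; _,_; proj₁; proj₂) renaming (map to map-Σ)
open import Data.Sum using (_⊎_; inj₁; inj₂)
open import Data.Empty using (⊥-elim)
open import Function using (_∘_; id)
open import Relation.Nullary using (¬_; yes; no; Dec; does)
open import Relation.Nullary.Decidable using (¬?; _→-dec_; _⊎-dec_; dec-true; dec-false)
open import Relation.Binary.PropositionalEquality
open import Data.Nat.Tactic.RingSolver using (solve-∀)

bit : Bool → ℕ
bit true = 1
bit false = 0

count : ∀ {m} → (Fin m → Bool) → ℕ
count {zero} f = 0
count {suc m} f = bit (f zero) + count (f ∘ suc)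

count-cong : ∀ {m} (f g : Fin m → Bool) → (∀ i → f i ≡ g i) → count f ≡ count g
count-cong {zero} f g e = refl
count-cong {suc m} f g e rewrite e zero = cong (bit (g zero) +_) (count-cong (f ∘ suc) (g ∘ suc) (e ∘ suc))

count≤ : ∀ {m} (f : Fin m → Bool) → count f ≤ m
count≤ {zero} f = z≤n
count≤ {suc m} f with f zero
... | true = s≤s (count≤ (f ∘ suc))
... | false = m≤n⇒m≤1+n (count≤ (f ∘ suc))

count-none : ∀ {m} (f : Fin m → Bool) → (∀ i → f i ≡ false) → count f ≡ 0
count-none {zero} f h = refl
count-none {suc m} f h rewrite h zero = count-none (f ∘ suc) (h ∘ suc)

count-all : ∀ {m} (f : Fin m → Bool) → (∀ i → f i ≡ true) → count f ≡ m
count-all {zero} f h = refl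
count-all {suc m} f h rewrite h zero = cong suc (count-all (f ∘ suc) (h ∘ suc))

count-full : ∀ {m} (f : Fin m → Bool) → count f ≡ m → ∀ i → f i ≡ true
count-full {suc m} f e i with f zero in f0
count-full {suc m} f e zero | true = f0
count-full {suc m} f e (suc i) | true = count-full (f ∘ suc) (suc-injective e) i
... | false = ⊥-elim (<-irrefl e (s≤s (count≤ (f ∘ suc))))

count-pos : ∀ {m} (f : Fin m → Bool) i → f i ≡ true → 0 < count f
count-pos f zero e rewrite e = s≤s z≤n
count-pos f (suc i) e with f zero
... | true = s≤s z≤n
... | false = count-pos (f ∘ suc) i e

count-pos⇒true : ∀ {m} (f : Fin m → Bool) → 0 < count f → ∃ λ i → f i ≡ true
count-pos⇒true {suc m} f h with f zero in f0
... | true = zero , f0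
... | false = map-Σ suc id (count-pos⇒true (f ∘ suc) h)

count-flip : ∀ {m} (f g : Fin m → Bool) (c : Fin m) → f c ≡ false → g c ≡ true →
             (∀ i → i ≢ c → g i ≡ f i) → count g ≡ suc (count f)
count-flip f g zero fc gc h rewrite fc | gc =
  cong suc (count-cong (g ∘ suc) (f ∘ suc) (λ i → h (suc i) (λ ())))
count-flip f g (suc c) fc gc h rewrite h zero (λ ()) =
  trans (cong (bit (f zero) +_) (count-flip (f ∘ suc) (g ∘ suc) c fc gc (λ i i≢c → h (suc i) (i≢c ∘ Fin-suc-injective))))
        (+-suc (bit (f zero)) (count (f ∘ suc)))

true≢false : true ≢ false
true≢false ()

count-disjoint : ∀ {m} (f g : Fin m → Bool) → (∀ i → f i ≡ true → g i ≡ false) → count f + count g ≤ m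
count-disjoint {zero} f g h = z≤n
count-disjoint {suc m} f g h with f zero in f0 | g zero in g0
... | true | true = ⊥-elim (true≢false (trans (sym g0) (h zero f0)))
... | true | false = s≤s (count-disjoint (f ∘ suc) (g ∘ suc) (h ∘ suc))
... | false | true = subst (_≤ suc m) (sym (+-suc (count (f ∘ suc)) (count (g ∘ suc))))
                        (s≤s (count-disjoint (f ∘ suc) (g ∘ suc) (h ∘ suc)))
... | false | false = m≤n⇒m≤1+n (count-disjoint (f ∘ suc) (g ∘ suc) (h ∘ suc))

count-room : ∀ {m} (f g : Fin m → Bool) → count f + count g < m → ∃ λ i → f i ≡ false × g i ≡ false
count-room {suc m} f g h with f zero in f0 | g zero in g0
... | false | false = zero , f0 , g0
... | true | _ = map-Σ suc id (count-room (f ∘ suc) (g ∘ suc)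
                   (≤-<-trans (+-monoʳ-≤ (count (f ∘ suc)) (m≤n+m (count (g ∘ suc)) _)) (≤-pred h)))
... | false | true = map-Σ suc id (count-room (f ∘ suc) (g ∘ suc)
                      (≤-pred (subst (_< suc m) (+-suc (count (f ∘ suc)) (count (g ∘ suc))) h)))

∈⇒true : ∀ {m} {S : Subset m} {x} → x ∈ S → lookup S x ≡ true
∈⇒true = []=⇒lookup

true⇒∈ : ∀ {m} {S : Subset m} {x} → lookup S x ≡ true → x ∈ S
true⇒∈ {S = S} {x} = lookup⇒[]= x S

false⇒∉ : ∀ {m} {S : Subset m} {x} → lookup S x ≡ false → x ∉ S
false⇒∉ e x∈S with trans (sym e) (∈⇒true x∈S)
... | ()

∉⇒false : ∀ {m} {S : Subset m} {x} → x ∉ S → lookup S x ≡ false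
∉⇒false {S = S} {x} x∉S with lookup S x in e
... | true = ⊥-elim (x∉S (true⇒∈ e))
... | false = refl

lookup-claim-here : ∀ {m} (S : Subset m) x → lookup (S ∪ ⁅ x ⁆) x ≡ true
lookup-claim-here S x rewrite lookup-zipWith _∨_ x S ⁅ x ⁆ | ∈⇒true (x∈⁅x⁆ x) = ∨-zeroʳ (lookup S x)

lookup-claim-elsewhere : ∀ {m} (S : Subset m) x y → y ≢ x → lookup (S ∪ ⁅ x ⁆) y ≡ lookup S y
lookup-claim-elsewhere S x y y≢x
  rewrite lookup-zipWith _∨_ y S ⁅ x ⁆ | ∉⇒false (x≢y⇒x∉⁅y⁆ y≢x) = ∨-identityʳ (lookup S y)

∈tabulate⇒ : ∀ {m} {f : Fin m → Bool} {x} → x ∈ tabulate f → f x ≡ true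
∈tabulate⇒ {f = f} {x} x∈ = trans (sym (lookup∘tabulate f x)) (∈⇒true x∈)

⇒∈tabulate : ∀ {m} {f : Fin m → Bool} {x} → f x ≡ true → x ∈ tabulate f
⇒∈tabulate {f = f} {x} e = true⇒∈ (trans (lookup∘tabulate f x) e)

does-≟⇒≡ : ∀ {k} {u w : Fin k} → does (u ≟ w) ≡ true → u ≡ w
does-≟⇒≡ {u = u} {w} e with u ≟ w
... | yes u≡w = u≡w

does-≟-cong : ∀ {k l} {u w : Fin k} {u′ w′ : Fin l} → (u ≡ w → u′ ≡ w′) → (u′ ≡ w′ → u ≡ w) →
              does (u ≟ w) ≡ does (u′ ≟ w′)
does-≟-cong {u = u} {w} {u′} {w′} there back with u ≟ w
... | yes u≡w = sym (dec-true (u′ ≟ w′) (there u≡w))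
... | no u≢w = sym (dec-false (u′ ≟ w′) (u≢w ∘ back))

does-≟-⟨$⟩ˡ : ∀ {k} (π : Permutation′ k) c d → does (π ⟨$⟩ˡ c ≟ d) ≡ does (c ≟ π ⟨$⟩ʳ d)
does-≟-⟨$⟩ˡ π c d = does-≟-cong (λ e → trans (sym (inverseʳ π)) (cong (π ⟨$⟩ʳ_) e))
                                (λ e → trans (cong (π ⟨$⟩ˡ_) e) (inverseˡ π))

module Grid (p q : ℕ) where

  N : ℕ
  N = p * q

  cell : Fin p → Fin q → Fin N
  cell = combine {p} {q}

  row : Fin N → Fin p
  row x = proj₁ (remQuot {p} q x)

  col : Fin N → Fin q
  col x = proj₂ (remQuot {p} q x)

  row-cell : ∀ a b → row (cell a b) ≡ a
  row-cell a b = cong proj₁ (remQuot-combine {p} {q} a b)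

  col-cell : ∀ a b → col (cell a b) ≡ b
  col-cell a b = cong proj₂ (remQuot-combine {p} {q} a b)

  cell-row-col : ∀ x → cell (row x) (col x) ≡ x
  cell-row-col x = combine-remQuot {p} q x

  cell-of : ∀ x {a} {b} → a ≡ row x → b ≡ col x → cell a b ≡ x
  cell-of x refl refl = cell-row-col x

  rowLine : Fin p → Subset N
  rowLine a = tabulate (λ x → does (row x ≟ a))

  transversal : Vec (Fin q) p → Subset N
  transversal v = tabulate (λ x → does (lookup v (row x) ≟ col x))

  allVecs : ∀ k → List (Vec (Fin q) k)
  allVecs zero = [] ∷ₗ []ₗ
  allVecs (suc k) = cartesianProductWith _∷_ (allFin q) (allVecs k)

  ∈-allVecs : ∀ {k} (v : Vec (Fin q) k) → v ∈ₗ allVecs k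
  ∈-allVecs [] = here refl
  ∈-allVecs (b ∷ v) = ∈-cartesianProductWith⁺ _∷_ (∈-allFin b) (∈-allVecs v)

  lines : Lines N
  lines = map rowLine (allFin p) ++ map transversal (allVecs p)

  rowLine∈lines : ∀ a → rowLine a ∈ₗ lines
  rowLine∈lines a = ∈-++⁺ˡ (∈-map⁺ rowLine (∈-allFin a))

  transversal∈lines : ∀ v → transversal v ∈ₗ lines
  transversal∈lines v = ∈-++⁺ʳ (map rowLine (allFin p)) (∈-map⁺ transversal (∈-allVecs v))

  lines-cases : ∀ {ℓ} → ℓ ∈ₗ lines → (∃ λ a → ℓ ≡ rowLine a) ⊎ (∃ λ v → ℓ ≡ transversal v)
  lines-cases ℓ∈ with ∈-++⁻ (map rowLine (allFin p)) ℓ∈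
  ... | inj₁ ∈rows = let (a , _ , e) = ∈-map⁻ rowLine ∈rows in inj₁ (a , e)
  ... | inj₂ ∈transversals = let (v , _ , e) = ∈-map⁻ transversal ∈transversals in inj₂ (v , e)

  inRow : Subset N → Fin p → Fin q → Bool
  inRow S a b = lookup S (cell a b)

  hits : Subset N → Fin p → ℕ
  hits S a = count (inRow S a)

  size : Subset N → ℕ
  size S = count (lookup S)

  fills⇒completes : ∀ S a → (∀ b → inRow S a b ≡ true) → Completes lines S
  fills⇒completes S a full = lose (rowLine∈lines a) rowLine⊆S
    where
    rowLine⊆S : rowLine a ⊆ S
    rowLine⊆S {x} x∈ = true⇒∈ (subst (λ y → lookup S y ≡ true)
                                  (cell-of x (sym (does-≟⇒≡ (∈tabulate⇒ x∈))) refl) (full (col x)))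

  meets⇒completes : ∀ S → (∀ a → ∃ λ b → inRow S a b ≡ true) → Completes lines S
  meets⇒completes S meets = lose (transversal∈lines v) transversal⊆S
    where
    v : Vec (Fin q) p
    v = tabulate (λ a → proj₁ (meets a))
    transversal⊆S : transversal v ⊆ S
    transversal⊆S {x} x∈ = true⇒∈ (subst (λ y → lookup S y ≡ true) (cell-of x refl chosen) (proj₂ (meets (row x))))
      where
      chosen : proj₁ (meets (row x)) ≡ col x
      chosen = trans (sym (lookup∘tabulate (λ a → proj₁ (meets a)) (row x))) (does-≟⇒≡ (∈tabulate⇒ x∈))

  completes⇒ : ∀ S → Completes lines S →
               (∃ λ a → ∀ b → inRow S a b ≡ true) ⊎ (∀ a → ∃ λ b → inRow S a b ≡ true)
  completes⇒ S completes with find completes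
  ... | ℓ , ℓ∈ , ℓ⊆S with lines-cases ℓ∈
  ... | inj₁ (a , refl) = inj₁ (a , λ b → ∈⇒true (ℓ⊆S (⇒∈tabulate (dec-true (row (cell a b) ≟ a) (row-cell a b)))))
  ... | inj₂ (v , refl) = inj₂ (λ a → lookup v a , ∈⇒true (ℓ⊆S (⇒∈tabulate
          (dec-true (lookup v (row (cell a (lookup v a))) ≟ col (cell a (lookup v a)))
                    (trans (cong (lookup v) (row-cell a _)) (sym (col-cell a _)))))))

  Lost : Subset N → Set
  Lost S = (∃ λ a → hits S a ≡ q) ⊎ (∀ a → 0 < hits S a)

  lost? : ∀ S → Dec (Lost S)
  lost? S = any? (λ a → hits S a Data.Nat.≟ q) ⊎-dec all? (λ a → 0 <? hits S a)

  lost⇒completes : ∀ S → Lost S → Completes lines S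
  lost⇒completes S (inj₁ (a , full)) = fills⇒completes S a (count-full (inRow S a) full)
  lost⇒completes S (inj₂ meets) = meets⇒completes S (λ a → count-pos⇒true (inRow S a) (meets a))

  safe⇒¬completes : ∀ S → (∀ a → hits S a < q) → (∃ λ a → hits S a ≡ 0) → ¬ Completes lines S
  safe⇒¬completes S short (a₀ , missed) completes with completes⇒ S completes
  ... | inj₁ (a , full) = <-irrefl (count-all (inRow S a) full) (short a)
  ... | inj₂ meets = let (b , e) = meets a₀ in <-irrefl (sym missed) (count-pos (inRow S a₀) b e)

  Disjoint : Subset N → Subset N → Set
  Disjoint A B = ∀ x → lookup A x ≡ true → lookup B x ≡ false

  hits-disjoint : ∀ A B a → Disjoint A B → hits A a + hits B a ≤ q
  hits-disjoint A B a disjoint = count-disjoint (inRow A a) (inRow B a) (λ b → disjoint (cell a b))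

  size-disjoint : ∀ A B → Disjoint A B → size A + size B ≤ N
  size-disjoint A B = count-disjoint (lookup A) (lookup B)

  room-in-row : ∀ A B a → hits A a + hits B a < q → ∃ λ b → inRow A a b ≡ false × inRow B a b ≡ false
  room-in-row A B a = count-room (inRow A a) (inRow B a)

  disjoint-claimˡ : ∀ {A B} y → Disjoint A B → lookup B y ≡ false → Disjoint (A ∪ ⁅ y ⁆) B
  disjoint-claimˡ {A} y disjoint y∉B w w∈A′ with w ≟ y
  ... | yes refl = y∉B
  ... | no w≢y = disjoint w (trans (sym (lookup-claim-elsewhere A y w w≢y)) w∈A′)

  disjoint-claimʳ : ∀ {A B} x → Disjoint A B → lookup A x ≡ false → Disjoint A (B ∪ ⁅ x ⁆)
  disjoint-claimʳ {A} {B} x disjoint x∉A w w∈A with w ≟ x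
  ... | yes refl = ⊥-elim (true≢false (trans (sym w∈A) x∉A))
  ... | no w≢x = trans (lookup-claim-elsewhere B x w w≢x) (disjoint w w∈A)

  record Added (S S′ : Subset N) (t : Fin p) : Set where
    field
      size-grows : size S′ ≡ suc (size S)
      row-grows : hits S′ t ≡ suc (hits S t)
      others-fixed : ∀ a → a ≢ t → hits S′ a ≡ hits S a

  claim-added : ∀ S x → lookup S x ≡ false → Added S (S ∪ ⁅ x ⁆) (row x)
  claim-added S x x∉S = record
    { size-grows = count-flip (lookup S) (lookup (S ∪ ⁅ x ⁆)) x x∉S (lookup-claim-here S x)
                     (lookup-claim-elsewhere S x)
    ; row-grows = count-flip (inRow S (row x)) (inRow (S ∪ ⁅ x ⁆) (row x)) (col x)
                    (trans (cong (lookup S) (cell-row-col x)) x∉S)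
                    (trans (cong (lookup (S ∪ ⁅ x ⁆)) (cell-row-col x)) (lookup-claim-here S x))
                    (λ b b≢ → lookup-claim-elsewhere S x (cell (row x) b)
                                (λ e → b≢ (trans (sym (col-cell (row x) b)) (cong col e))))
    ; others-fixed = λ a a≢ → count-cong (inRow (S ∪ ⁅ x ⁆) a) (inRow S a)
                       (λ b → lookup-claim-elsewhere S x (cell a b)
                                (λ e → a≢ (trans (sym (row-cell a b)) (cong row e))))
    }

  added-mono : ∀ {S S′ t} → Added S S′ t → ∀ a → hits S a ≤ hits S′ a
  added-mono {S} {t = t} added a with a ≟ t
  ... | yes refl = subst (hits S a ≤_) (sym (Added.row-grows added)) (n≤1+n (hits S a))
  ... | no a≢t = ≤-reflexive (sym (Added.others-fixed added a a≢t))

  module _ (α : Permutation′ p) (β : Permutation′ q) where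

    gridPerm : Permutation′ N
    gridPerm = permutation to from to∘from from∘to
      where
      to from : Fin N → Fin N
      to x = cell (α ⟨$⟩ʳ row x) (β ⟨$⟩ʳ col x)
      from y = cell (α ⟨$⟩ˡ row y) (β ⟨$⟩ˡ col y)
      to∘from : ∀ y → to (from y) ≡ y
      to∘from y = cell-of y (trans (cong (α ⟨$⟩ʳ_) (row-cell _ _)) (inverseʳ α))
                            (trans (cong (β ⟨$⟩ʳ_) (col-cell _ _)) (inverseʳ β))
      from∘to : ∀ x → from (to x) ≡ x
      from∘to x = cell-of x (trans (cong (α ⟨$⟩ˡ_) (row-cell _ _)) (inverseˡ α))
                            (trans (cong (β ⟨$⟩ˡ_) (col-cell _ _)) (inverseˡ β))

    image-rowLine : ∀ a → image gridPerm (rowLine a) ≡ rowLine (α ⟨$⟩ʳ a)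
    image-rowLine a = tabulate-cong λ y → begin
      lookup (rowLine a) (gridPerm ⟨$⟩ˡ y)          ≡⟨ lookup∘tabulate (λ x → does (row x ≟ a)) _ ⟩
      does (row (gridPerm ⟨$⟩ˡ y) ≟ a)              ≡⟨ cong (λ c → does (c ≟ a)) (row-cell _ _) ⟩
      does (α ⟨$⟩ˡ row y ≟ a)                       ≡⟨ does-≟-⟨$⟩ˡ α (row y) a ⟩
      does (row y ≟ α ⟨$⟩ʳ a)                       ∎
      where open ≡-Reasoning

    permuteVec : Vec (Fin q) p → Vec (Fin q) p
    permuteVec v = tabulate (λ a → β ⟨$⟩ʳ lookup v (α ⟨$⟩ˡ a))

    image-transversal : ∀ v → image gridPerm (transversal v) ≡ transversal (permuteVec v)
    image-transversal v = tabulate-cong λ y → begin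
      lookup (transversal v) (gridPerm ⟨$⟩ˡ y)
        ≡⟨ lookup∘tabulate (λ x → does (lookup v (row x) ≟ col x)) _ ⟩
      does (lookup v (row (gridPerm ⟨$⟩ˡ y)) ≟ col (gridPerm ⟨$⟩ˡ y))
        ≡⟨ cong₂ (λ c d → does (lookup v c ≟ d)) (row-cell _ _) (col-cell _ _) ⟩
      does (lookup v (α ⟨$⟩ˡ row y) ≟ β ⟨$⟩ˡ col y)
        ≡⟨ does-≟-cong (λ e → trans (cong (β ⟨$⟩ʳ_) e) (inverseʳ β)) (λ e → trans (sym (inverseˡ β)) (cong (β ⟨$⟩ˡ_) e)) ⟩
      does (β ⟨$⟩ʳ lookup v (α ⟨$⟩ˡ row y) ≟ col y)
        ≡⟨ cong (λ c → does (c ≟ col y)) (sym (lookup∘tabulate (λ a → β ⟨$⟩ʳ lookup v (α ⟨$⟩ˡ a)) (row y))) ⟩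
      does (lookup (permuteVec v) (row y) ≟ col y) ∎
      where open ≡-Reasoning

    gridPerm-automorphism : IsAutomorphism lines gridPerm
    gridPerm-automorphism = forward , backward
      where
      forward : ∀ ℓ → ℓ ∈ₗ lines → image gridPerm ℓ ∈ₗ lines
      forward ℓ ℓ∈ with lines-cases ℓ∈
      ... | inj₁ (a , refl) = subst (_∈ₗ lines) (sym (image-rowLine a)) (rowLine∈lines (α ⟨$⟩ʳ a))
      ... | inj₂ (v , refl) = subst (_∈ₗ lines) (sym (image-transversal v)) (transversal∈lines (permuteVec v))
      backward : ∀ ℓ → ℓ ∈ₗ lines → Σ (Subset N) λ ℓ′ → ℓ′ ∈ₗ lines × image gridPerm ℓ′ ≡ ℓ
      backward ℓ ℓ∈ with lines-cases ℓ∈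
      ... | inj₁ (a , refl) = rowLine (α ⟨$⟩ˡ a) , rowLine∈lines _ ,
                              trans (image-rowLine _) (cong rowLine (inverseʳ α))
      ... | inj₂ (v , refl) = transversal v′ , transversal∈lines v′ ,
                              trans (image-transversal v′) (cong transversal permuteVec-v′)
        where
        v′ : Vec (Fin q) p
        v′ = tabulate (λ a → β ⟨$⟩ˡ lookup v (α ⟨$⟩ʳ a))
        permuteVec-v′ : permuteVec v′ ≡ v
        permuteVec-v′ = trans (tabulate-cong λ a →
          trans (cong (β ⟨$⟩ʳ_) (lookup∘tabulate (λ a → β ⟨$⟩ˡ lookup v (α ⟨$⟩ʳ a)) (α ⟨$⟩ˡ a)))
                (trans (inverseʳ β) (cong (lookup v) (inverseʳ α)))) (tabulate∘lookup v)

  transpose-maps : ∀ {k} (i j : Fin k) → transpose i j ⟨$⟩ʳ i ≡ j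
  transpose-maps i j rewrite dec-true (i ≟ i) refl = refl

  transitive : IsTransitive lines
  transitive x y = gridPerm α β , gridPerm-automorphism α β ,
                   cell-of y (transpose-maps (row x) (row y)) (transpose-maps (col x) (col y))
    where
    α = transpose (row x) (row y)
    β = transpose (col x) (col y)

module Strategy {p q : ℕ} (π : Fin p → Fin p) (π-involutive : ∀ a → π (π a) ≡ a)
  (z : Fin p) (π-fixes-z : π z ≡ z) (π-fixed⇒z : ∀ a → π a ≡ a → a ≡ z)
  (q-odd : ∀ m → m + m ≢ q) (1<q : 1 < q) (other : Fin p) (other≢z : other ≢ z) where

  open Grid p q
  open Added

  π-injective : ∀ {a b} → π a ≡ π b → a ≡ b
  π-injective {a} {b} e = trans (sym (π-involutive a)) (trans (cong π e) (π-involutive b))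

  π-avoids-z : ∀ {a} → a ≢ z → π a ≢ z
  π-avoids-z {a} a≢z e = a≢z (trans (sym (π-involutive a)) (trans (cong π e) π-fixes-z))

  π-moves : ∀ {a} → a ≢ z → π a ≢ a
  π-moves a≢z e = a≢z (π-fixed⇒z _ e)

  -- Mirror phase (II to move): I holds II's rows reflected by π, plus one
  -- extra point in z.
  record Mirrored (A B : Subset N) : Set where
    field
      centre : hits A z ≡ suc (hits B z)
      reflected : ∀ a → a ≢ z → hits A (π a) ≡ hits B a

  -- Race phase about row k: II meets every row but z, so II can never enter
  -- z; I avoids π k; the rows other than z, k and π k are still mirrored.
  record Racing (A B : Subset N) (k : Fin p) : Set where
    field
      k≢z : k ≢ z
      B-avoids-z : hits B z ≡ 0
      B-meets : ∀ a → a ≢ z → 0 < hits B a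
      A-avoids-πk : hits A (π k) ≡ 0
      reflected-off : ∀ a → a ≢ z → a ≢ k → a ≢ π k → hits A (π a) ≡ hits B a

  -- The race balance between I's points in z and k and II's points in k and
  -- π k, with II to move ...
  Ahead : ℕ → ℕ → ℕ → ℕ → Set
  Ahead az ak bk bπk = az < bπk ⊎ (az ≡ bπk × ak ≡ suc bk) ⊎ (az ≡ bπk × ak + bk ≡ q)

  Ahead-cong : ∀ {az ak bk bπk az′ ak′ bk′ bπk′} → az ≡ az′ → ak ≡ ak′ → bk ≡ bk′ → bπk ≡ bπk′ →
               Ahead az ak bk bπk → Ahead az′ ak′ bk′ bπk′
  Ahead-cong refl refl refl refl ahead = ahead

  -- ... and with I to move.
  Level : ℕ → ℕ → ℕ → ℕ → Set
  Level az ak bk bπk = az < bπk ⊎ (az ≡ bπk × ak ≡ bk)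

  data Phase (A B : Subset N) : Set where
    mirror : Mirrored A B → (∃ λ a → a ≢ z × hits B a ≡ 0) → Phase A B
    race : ∀ k → Racing A B k → Ahead (hits A z) (hits A k) (hits B k) (hits B (π k)) → Phase A B

  racing-after-I : ∀ {A A′ B k u} → Racing A B k → Added A A′ u → u ≡ k ⊎ u ≡ z → Racing A′ B k
  racing-after-I {A′ = A′} {k = k} R added u∈kz = record
    { k≢z = k≢z
    ; B-avoids-z = B-avoids-z
    ; B-meets = B-meets
    ; A-avoids-πk = trans (others-fixed added (π k) (πk≢u u∈kz)) A-avoids-πk
    ; reflected-off = λ a a≢z a≢k a≢πk →
        trans (others-fixed added (π a) (πa≢u a≢z a≢πk u∈kz)) (reflected-off a a≢z a≢k a≢πk)
    }
    where
    open Racing R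
    πk≢u : ∀ {u} → u ≡ k ⊎ u ≡ z → π k ≢ u
    πk≢u (inj₁ refl) = π-moves k≢z
    πk≢u (inj₂ refl) = π-avoids-z k≢z
    πa≢u : ∀ {a u} → a ≢ z → a ≢ π k → u ≡ k ⊎ u ≡ z → π a ≢ u
    πa≢u {a} _ a≢πk (inj₁ refl) e = a≢πk (trans (sym (π-involutive a)) (cong π e))
    πa≢u a≢z _ (inj₂ refl) = π-avoids-z a≢z

  racing-after-II : ∀ {A B B′ k t} → Racing A B k → Added B B′ t → t ≡ k ⊎ t ≡ π k → Racing A B′ k
  racing-after-II {B′ = B′} {k = k} {t} R added t∈kπk = record
    { k≢z = k≢z
    ; B-avoids-z = trans (others-fixed added z (z≢t t∈kπk)) B-avoids-z
    ; B-meets = λ a a≢z → <-≤-trans (B-meets a a≢z) (added-mono added a)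
    ; A-avoids-πk = A-avoids-πk
    ; reflected-off = λ a a≢z a≢k a≢πk →
        trans (reflected-off a a≢z a≢k a≢πk) (sym (others-fixed added a (a≢t a≢k a≢πk t∈kπk)))
    }
    where
    open Racing R
    z≢t : ∀ {t} → t ≡ k ⊎ t ≡ π k → z ≢ t
    z≢t (inj₁ refl) e = k≢z (sym e)
    z≢t (inj₂ refl) e = π-avoids-z k≢z (sym e)
    a≢t : ∀ {a t} → a ≢ k → a ≢ π k → t ≡ k ⊎ t ≡ π k → a ≢ t
    a≢t a≢k _ (inj₁ refl) = a≢k
    a≢t _ a≢πk (inj₂ refl) = a≢πk

  record Legal (A B : Subset N) : Set where
    field
      disjoint : Disjoint A B
      A-short : ∀ a → hits A a < q

  -- Player I wins from every legal phase position with II to move, provided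
  -- r rounds of play would fill the board.
  WinsWithin : ℕ → Set
  WinsWithin r = ∀ A B → N ≤ size A + size B + (r + r) → Legal A B → Phase A B → IWinOnII lines A B

  module Reply (r : ℕ) (next : WinsWithin r) (A B′ : Subset N) (budget : N ≤ suc (size A + size B′ + (r + r)))
    (disjoint : Disjoint A B′) (A-short : ∀ a → hits A a < q) (B′-short : ∀ a → hits B′ a < q) where

    -- What I's move into row u must leave behind: row u is not full, some
    -- row is missed (so I completes no line), and a phase holds.
    Settled : Subset N → Set
    Settled A′ = (∃ λ a → hits A′ a ≡ 0) × Phase A′ B′

    Afterwards : Fin p → Subset N → Set
    Afterwards u A′ = hits A′ u < q × Settled A′

    play : ∀ u → hits A u + hits B′ u < q → (∀ A′ → Added A A′ u → Disjoint A′ B′ → Afterwards u A′) →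
           IWinOnI lines A B′
    play u room continue =
      move y (false⇒∉ y∉A) (false⇒∉ y∉B′) (safe⇒¬completes A′ A′-short (proj₁ (proj₂ outcome)))
        (next A′ B′ budget′ legal′ (proj₂ (proj₂ outcome)))
      where
      free = room-in-row A B′ u room
      y = cell u (proj₁ free)
      y∉A : lookup A y ≡ false
      y∉A = proj₁ (proj₂ free)
      y∉B′ : lookup B′ y ≡ false
      y∉B′ = proj₂ (proj₂ free)
      A′ = A ∪ ⁅ y ⁆
      added : Added A A′ u
      added = subst (Added A A′) (row-cell u (proj₁ free)) (claim-added A y y∉A)
      disjoint′ : Disjoint A′ B′
      disjoint′ = disjoint-claimˡ {A} {B′} y disjoint y∉B′
      outcome = continue A′ added disjoint′
      A′-short : ∀ a → hits A′ a < q
      A′-short a with a ≟ u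
      ... | yes refl = proj₁ outcome
      ... | no a≢u = subst (_< q) (sym (others-fixed added a a≢u)) (A-short a)
      legal′ : Legal A′ B′
      legal′ = record { disjoint = disjoint′ ; A-short = A′-short }
      budget′ : N ≤ size A′ + size B′ + (r + r)
      budget′ = subst (λ s → N ≤ s + size B′ + (r + r)) (sym (size-grows added)) budget

    -- Answer II's move in a mirrored row t ≠ z by a move in π t; there is
    -- room since I's count in π t plus II's equals the old total in t.
    answer : ∀ {B t} → Added B B′ t → t ≢ z → hits A (π t) ≡ hits B t → hits A t ≡ hits B (π t) →
             (∀ A′ → Added A A′ (π t) → hits A′ (π t) ≡ hits B′ t → Settled A′) →
             IWinOnI lines A B′
    answer {B} {t} added t≢z A-πt A-t continue = play (π t) room λ A′ addedA _ →
      let A′-πt = trans (row-grows addedA) (trans (cong suc A-πt) (sym (row-grows added)))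
      in subst (_< q) (sym A′-πt) (B′-short t) , continue A′ addedA A′-πt
      where
      room : hits A (π t) + hits B′ (π t) < q
      room = begin-strict
        hits A (π t) + hits B′ (π t) ≡⟨ cong₂ _+_ A-πt (trans (others-fixed added (π t) (π-moves t≢z)) (sym A-t)) ⟩
        hits B t + hits A t          ≡⟨ +-comm (hits B t) (hits A t) ⟩
        hits A t + hits B t          <⟨ +-monoʳ-< (hits A t) (n<1+n (hits B t)) ⟩
        hits A t + suc (hits B t)    ≡⟨ cong (hits A t +_) (sym (row-grows added)) ⟩
        hits A t + hits B′ t         ≤⟨ hits-disjoint A B′ t disjoint ⟩
        q                            ∎
        where open ≤-Reasoning

    -- II moved in row t of a mirror position and still misses a₀ ≠ z.  A
    -- move in z is answered in z, where room remains because q is odd.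
    keepMirroring : ∀ {B t} → Added B B′ t → Mirrored A B → ∀ a₀ → a₀ ≢ z → hits B′ a₀ ≡ 0 → IWinOnI lines A B′
    keepMirroring {B} {t} added m a₀ a₀≢z B′-a₀ with t ≟ z
    ... | yes refl = play z room continue
      where
      open Mirrored m
      balanced : hits A z ≡ hits B′ z
      balanced = trans centre (sym (row-grows added))
      room : hits A z + hits B′ z < q
      room = ≤∧≢⇒< (hits-disjoint A B′ z disjoint)
                   (λ e → q-odd (hits B′ z) (trans (cong (_+ hits B′ z) (sym balanced)) e))
      continue : ∀ A′ → Added A A′ z → Disjoint A′ B′ → Afterwards z A′
      continue A′ addedA disjoint′ =
        <-≤-trans (m<m+n (hits A′ z) B′-z-pos) (hits-disjoint A′ B′ z disjoint′) ,
        (π a₀ , trans (reflected′ a₀ a₀≢z) B′-a₀) ,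
        mirror (record { centre = trans (row-grows addedA) (cong suc balanced) ; reflected = reflected′ })
               (a₀ , a₀≢z , B′-a₀)
        where
        B′-z-pos : 0 < hits B′ z
        B′-z-pos = subst (0 <_) (sym (row-grows added)) (s≤s z≤n)
        reflected′ : ∀ a → a ≢ z → hits A′ (π a) ≡ hits B′ a
        reflected′ a a≢z = trans (others-fixed addedA (π a) (π-avoids-z a≢z))
                                 (trans (reflected a a≢z) (sym (others-fixed added a a≢z)))
    ... | no t≢z = answer added t≢z (reflected t t≢z) A-t continue
      where
      open Mirrored m
      A-t : hits A t ≡ hits B (π t)
      A-t = trans (cong (hits A) (sym (π-involutive t))) (reflected (π t) (π-avoids-z t≢z))
      continue : ∀ A′ → Added A A′ (π t) → hits A′ (π t) ≡ hits B′ t → Settled A′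
      continue A′ addedA A′-πt =
        (π a₀ , trans (reflected′ a₀ a₀≢z) B′-a₀) ,
        mirror (record { centre = centre′ ; reflected = reflected′ }) (a₀ , a₀≢z , B′-a₀)
        where
        centre′ : hits A′ z ≡ suc (hits B′ z)
        centre′ = trans (others-fixed addedA z (λ e → π-avoids-z t≢z (sym e)))
                        (trans centre (cong suc (sym (others-fixed added z (λ e → t≢z (sym e))))))
        reflected′ : ∀ a → a ≢ z → hits A′ (π a) ≡ hits B′ a
        reflected′ a a≢z with a ≟ t
        ... | yes refl = A′-πt
        ... | no a≢t = trans (others-fixed addedA (π a) (a≢t ∘ π-injective))
                             (trans (reflected a a≢z) (sym (others-fixed added a a≢t)))

    -- I's move in a race about k: into k while it has room (I cannot fill
    -- k, which II meets), otherwise into z, where I's count stays at most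
    -- II's count in π k.  I never touches π k, hence never meets every row.
    raceStep : ∀ k → Racing A B′ k → Level (hits A z) (hits A k) (hits B′ k) (hits B′ (π k)) → IWinOnI lines A B′
    raceStep k R level with hits A k + hits B′ k <? q
    ... | yes room = play k room continue
      where
      open Racing R
      continue : ∀ A′ → Added A A′ k → Disjoint A′ B′ → Afterwards k A′
      continue A′ addedA disjoint′ =
        <-≤-trans (m<m+n (hits A′ k) (B-meets k k≢z)) (hits-disjoint A′ B′ k disjoint′) ,
        (π k , Racing.A-avoids-πk R′) , race k R′ (toAhead level)
        where
        R′ : Racing A′ B′ k
        R′ = racing-after-I R addedA (inj₁ refl)
        A′-z : hits A′ z ≡ hits A z
        A′-z = others-fixed addedA z (λ e → k≢z (sym e))
        toAhead : Level (hits A z) (hits A k) (hits B′ k) (hits B′ (π k)) →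
                  Ahead (hits A′ z) (hits A′ k) (hits B′ k) (hits B′ (π k))
        toAhead (inj₁ behind) = inj₁ (subst (_< hits B′ (π k)) (sym A′-z) behind)
        toAhead (inj₂ (same-z , same-k)) =
          inj₂ (inj₁ (trans A′-z same-z , trans (row-grows addedA) (cong suc same-k)))
    ... | no no-room = play z room continue
      where
      open Racing R
      full : hits A k + hits B′ k ≡ q
      full = ≤-antisym (hits-disjoint A B′ k disjoint) (≮⇒≥ no-room)
      -- A full row k cannot be shared equally, q being odd.
      strictly : Level (hits A z) (hits A k) (hits B′ k) (hits B′ (π k)) → hits A z < hits B′ (π k)
      strictly (inj₁ lt) = lt
      strictly (inj₂ (_ , same-k)) = ⊥-elim (q-odd (hits B′ k) (trans (cong (_+ hits B′ k) (sym same-k)) full))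
      behind : hits A z < hits B′ (π k)
      behind = strictly level
      room : hits A z + hits B′ z < q
      room = subst (λ c → hits A z + c < q) (sym B-avoids-z)
               (subst (_< q) (sym (+-identityʳ (hits A z))) (<-trans behind (B′-short (π k))))
      continue : ∀ A′ → Added A A′ z → Disjoint A′ B′ → Afterwards z A′
      continue A′ addedA disjoint′ =
        ≤-<-trans A′-z≤ (B′-short (π k)) , (π k , Racing.A-avoids-πk R′) , race k R′ ahead
        where
        R′ : Racing A′ B′ k
        R′ = racing-after-I R addedA (inj₂ refl)
        A′-z≤ : hits A′ z ≤ hits B′ (π k)
        A′-z≤ = subst (_≤ hits B′ (π k)) (sym (row-grows addedA)) behind
        ahead : Ahead (hits A′ z) (hits A′ k) (hits B′ k) (hits B′ (π k))
        ahead with m≤n⇒m<n∨m≡n A′-z≤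
        ... | inj₁ lt = inj₁ lt
        ... | inj₂ eq = inj₂ (inj₂ (eq , trans (cong (_+ hits B′ k) (others-fixed addedA k k≢z)) full))

    -- II moved in row t of a race position about k.  A move in k or π k
    -- keeps the race (I is still level); any other row is mirrored.
    continueRace : ∀ {B t} → Added B B′ t → ∀ k → Racing A B k →
                   Ahead (hits A z) (hits A k) (hits B k) (hits B (π k)) → (∃ λ a → hits B′ a ≡ 0) →
                   IWinOnI lines A B′
    continueRace {B} {t} added k R ahead B′-misses with t ≟ k | t ≟ π k
    ... | yes refl | _ = raceStep k (racing-after-II R added (inj₁ refl)) (toLevel ahead)
      where
      open Racing R
      B′-πk : hits B′ (π k) ≡ hits B (π k)
      B′-πk = others-fixed added (π k) (π-moves k≢z)
      toLevel : Ahead (hits A z) (hits A k) (hits B k) (hits B (π k)) →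
                Level (hits A z) (hits A k) (hits B′ k) (hits B′ (π k))
      toLevel (inj₁ behind) = inj₁ (subst (hits A z <_) (sym B′-πk) behind)
      toLevel (inj₂ (inj₁ (same-z , one-more))) = inj₂ (trans same-z (sym B′-πk) , trans one-more (sym (row-grows added)))
      toLevel (inj₂ (inj₂ (_ , full))) = ⊥-elim (<-irrefl full (subst (_≤ q)
              (trans (cong (hits A k +_) (row-grows added)) (+-suc (hits A k) (hits B k)))
              (hits-disjoint A B′ k disjoint)))
    ... | no _ | yes refl = raceStep k (racing-after-II R added (inj₂ refl))
                                 (inj₁ (subst (hits A z <_) (sym (row-grows added)) (s≤s (at-most ahead))))
      where
      at-most : Ahead (hits A z) (hits A k) (hits B k) (hits B (π k)) → hits A z ≤ hits B (π k)
      at-most (inj₁ behind) = <⇒≤ behind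
      at-most (inj₂ (inj₁ (same-z , _))) = ≤-reflexive same-z
      at-most (inj₂ (inj₂ (same-z , _))) = ≤-reflexive same-z
    ... | no t≢k | no t≢πk = answer added t≢z (reflected-off t t≢z t≢k t≢πk) A-t continue
      where
      open Racing R
      -- II's points outside z already meet every row, so II cannot have entered z.
      entered-z⇒meets : t ≡ z → ∀ c → 0 < hits B′ c
      entered-z⇒meets refl c with c ≟ z
      ... | yes refl = subst (0 <_) (sym (row-grows added)) (s≤s z≤n)
      ... | no c≢z = <-≤-trans (B-meets c c≢z) (added-mono added c)
      t≢z : t ≢ z
      t≢z t≡z = let (c , B′-c) = B′-misses in <-irrefl (sym B′-c) (entered-z⇒meets t≡z c)
      A-t : hits A t ≡ hits B (π t)
      A-t = trans (cong (hits A) (sym (π-involutive t)))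
              (reflected-off (π t) (π-avoids-z t≢z) (λ e → t≢πk (trans (sym (π-involutive t)) (cong π e)))
                 (t≢k ∘ π-injective))
      continue : ∀ A′ → Added A A′ (π t) → hits A′ (π t) ≡ hits B′ t → Settled A′
      continue A′ addedA A′-πt = (π k , Racing.A-avoids-πk R′) , race k R′ ahead′
        where
        πt≢k : π t ≢ k
        πt≢k e = t≢πk (trans (sym (π-involutive t)) (cong π e))
        R′ : Racing A′ B′ k
        R′ = record
          { k≢z = k≢z
          ; B-avoids-z = trans (others-fixed added z (λ e → t≢z (sym e))) B-avoids-z
          ; B-meets = λ a a≢z → <-≤-trans (B-meets a a≢z) (added-mono added a)
          ; A-avoids-πk = trans (others-fixed addedA (π k) (λ e → t≢k (sym (π-injective e)))) A-avoids-πk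
          ; reflected-off = reflected′
          }
          where
          reflected′ : ∀ a → a ≢ z → a ≢ k → a ≢ π k → hits A′ (π a) ≡ hits B′ a
          reflected′ a a≢z a≢k a≢πk with a ≟ t
          ... | yes refl = A′-πt
          ... | no a≢t = trans (others-fixed addedA (π a) (a≢t ∘ π-injective))
                               (trans (reflected-off a a≢z a≢k a≢πk) (sym (others-fixed added a a≢t)))
        ahead′ : Ahead (hits A′ z) (hits A′ k) (hits B′ k) (hits B′ (π k))
        ahead′ = Ahead-cong (sym (others-fixed addedA z (λ e → π-avoids-z t≢z (sym e))))
                            (sym (others-fixed addedA k (λ e → πt≢k (sym e))))
                            (sym (others-fixed added k (λ e → t≢k (sym e))))
                            (sym (others-fixed added (π k) (λ e → t≢πk (sym e))))
                            ahead

    -- II has just met every row but z, in row t: the race about t starts.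
    -- Then I holds exactly one point in z and II exactly one in t.
    startRace : ∀ {B t} → Added B B′ t → Mirrored A B → (∃ λ a → a ≢ z × hits B a ≡ 0) →
                (∀ a → a ≢ z → 0 < hits B′ a) → (∃ λ a → hits B′ a ≡ 0) → IWinOnI lines A B′
    startRace {B} {t} added m (a₀ , a₀≢z , B-a₀) B′-meets (c , B′-c) = raceStep t R level
      where
      open Mirrored m
      B′-z : hits B′ z ≡ 0
      B′-z with c ≟ z
      ... | yes refl = B′-c
      ... | no c≢z = ⊥-elim (<-irrefl (sym B′-c) (B′-meets c c≢z))
      t≢z : t ≢ z
      t≢z refl = 0≢1+n (trans (sym B′-z) (row-grows added))
      B-t : hits B t ≡ 0
      B-t with a₀ ≟ t
      ... | yes refl = B-a₀
      ... | no a₀≢t = ⊥-elim (<-irrefl (sym (trans (others-fixed added a₀ a₀≢t) B-a₀)) (B′-meets a₀ a₀≢z))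
      R : Racing A B′ t
      R = record
        { k≢z = t≢z
        ; B-avoids-z = B′-z
        ; B-meets = B′-meets
        ; A-avoids-πk = trans (reflected t t≢z) B-t
        ; reflected-off = λ a a≢z a≢t _ → trans (reflected a a≢z) (sym (others-fixed added a a≢t))
        }
      A-z : hits A z ≡ 1
      A-z = trans centre (cong suc (trans (sym (others-fixed added z (λ e → t≢z (sym e)))) B′-z))
      B′-t : hits B′ t ≡ 1
      B′-t = trans (row-grows added) (cong suc B-t)
      A-t : hits A t ≡ hits B′ (π t)
      A-t = trans (cong (hits A) (sym (π-involutive t)))
              (trans (reflected (π t) (π-avoids-z t≢z)) (sym (others-fixed added (π t) (π-moves t≢z))))
      level : Level (hits A z) (hits A t) (hits B′ t) (hits B′ (π t))
      level with hits B′ (π t) Data.Nat.≟ 1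
      ... | yes one = inj₂ (trans A-z (sym one) , trans A-t (trans one (sym B′-t)))
      ... | no not-one = inj₁ (subst (_< hits B′ (π t)) (sym A-z)
                                 (≤∧≢⇒< (B′-meets (π t) (π-avoids-z t≢z)) (not-one ∘ sym)))

    reply : ∀ {B t} → Added B B′ t → Phase A B → (∃ λ a → hits B′ a ≡ 0) → IWinOnI lines A B′
    reply added (race k R ahead) B′-misses = continueRace added k R ahead B′-misses
    reply added (mirror m missing) B′-misses with all? (λ a → ¬? (a ≟ z) →-dec (0 <? hits B′ a))
    ... | yes B′-meets = startRace added m missing B′-meets B′-misses
    ... | no ¬B′-meets with ¬∀⟶∃¬ p _ (λ a → ¬? (a ≟ z) →-dec (0 <? hits B′ a)) ¬B′-meets
    ... | a₀ , ¬a₀ = keepMirroring added m a₀ (λ e → ¬a₀ (λ a₀≢z → ⊥-elim (a₀≢z e)))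
                                    (n≤0⇒n≡0 (≮⇒≥ (λ pos → ¬a₀ (λ _ → pos))))

  -- In a phase position II always has a free point: in a row II misses,
  -- which is not full for I either.
  free-point : ∀ {A B} → Legal A B → Phase A B → ∃ λ y → lookup A y ≡ false × lookup B y ≡ false
  free-point {A} {B} legal phase with missed-row phase
    where
    missed-row : Phase A B → ∃ λ a → hits B a ≡ 0
    missed-row (mirror _ (a₀ , _ , B-a₀)) = a₀ , B-a₀
    missed-row (race _ R _) = z , Racing.B-avoids-z R
  ... | a , B-a with room-in-row A B a (subst (_< q) (sym (trans (cong (hits A a +_) B-a) (+-identityʳ (hits A a))))
                                        (Legal.A-short legal a))
  ... | b , free-in-A , free-in-B = cell a b , free-in-A , free-in-B

  free⇒size< : ∀ A B y → Disjoint A B → lookup A y ≡ false → lookup B y ≡ false → size A + size B < N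
  free⇒size< A B y disjoint y∉A y∉B =
    subst (λ s → s + size B ≤ N) (size-grows (claim-added A y y∉A))
      (size-disjoint (A ∪ ⁅ y ⁆) B (disjoint-claimˡ {A} {B} y disjoint y∉B))

  -- One round claims one point for each player.
  budget-step : ∀ a b r → a + b + (suc r + suc r) ≡ suc (a + suc b + (r + r))
  budget-step = solve-∀

  -- Player I wins every phase position; the budget of rounds makes the
  -- recursion structural, and budget zero is impossible by 'free-point'.
  wins : ∀ r → WinsWithin r
  wins zero A B budget legal phase =
    let (y , y∉A , y∉B) = free-point legal phase
    in ⊥-elim (<⇒≱ (free⇒size< A B y (Legal.disjoint legal) y∉A y∉B)
                    (subst (N ≤_) (+-identityʳ (size A + size B)) budget))
  wins (suc r) A B budget legal phase =
    let (y , y∉A , y∉B) = free-point legal phase in respond (y , false⇒∉ y∉A , false⇒∉ y∉B) replyTo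
    where
    replyTo : ∀ x → x ∉ A → x ∉ B → Completes lines (B ∪ ⁅ x ⁆) ⊎ IWinOnI lines A (B ∪ ⁅ x ⁆)
    replyTo x x∉A x∉B with lost? (B ∪ ⁅ x ⁆)
    ... | yes lost = inj₁ (lost⇒completes (B ∪ ⁅ x ⁆) lost)
    ... | no alive = inj₂ (Reply.reply r (wins r) A B′ budget′
                             (disjoint-claimʳ {A} {B} x (Legal.disjoint legal) (∉⇒false x∉A))
                             (Legal.A-short legal) B′-short added phase B′-misses)
      where
      B′ = B ∪ ⁅ x ⁆
      added : Added B B′ (row x)
      added = claim-added B x (∉⇒false x∉B)
      budget′ : N ≤ suc (size A + size B′ + (r + r))
      budget′ = subst (N ≤_) (trans (budget-step (size A) (size B) r)
                                    (cong (λ s → suc (size A + s + (r + r))) (sym (size-grows added)))) budget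
      B′-short : ∀ a → hits B′ a < q
      B′-short a = ≤∧≢⇒< (count≤ (inRow B′ a)) (λ full → alive (inj₁ (a , full)))
      B′-misses : ∃ λ a → hits B′ a ≡ 0
      B′-misses with ¬∀⟶∃¬ p (λ a → 0 < hits B′ a) (λ a → 0 <? hits B′ a) (λ meets → alive (inj₂ meets))
      ... | a , ¬pos = a , n≤0⇒n≡0 (≮⇒≥ ¬pos)

  empty-hits : ∀ a → hits ⊥ a ≡ 0
  empty-hits a = count-none (inRow ⊥ a) (λ b → ∉⇒false (∉⊥ {x = cell a b}))

  playerIWin : PlayerIWin lines
  playerIWin = Reply.play N (wins N) ⊥ ⊥ budget (λ x _ → ∉⇒false (∉⊥ {x = x})) empty-short empty-short
                          z room continue
    where
    empty-short : ∀ a → hits ⊥ a < q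
    empty-short a = subst (_< q) (sym (empty-hits a)) (<-trans (s≤s z≤n) 1<q)
    budget : N ≤ suc (size ⊥ + size ⊥ + (N + N))
    budget = ≤-trans (m≤m+n N N) (≤-trans (m≤n+m (N + N) (size ⊥ + size ⊥)) (n≤1+n _))
    room : hits ⊥ z + hits ⊥ z < q
    room = subst (_< q) (sym (cong₂ _+_ (empty-hits z) (empty-hits z))) (<-trans (s≤s z≤n) 1<q)
    continue : ∀ A′ → Added ⊥ A′ z → Disjoint A′ ⊥ → hits A′ z < q × (∃ λ a → hits A′ a ≡ 0) × Phase A′ ⊥
    continue A′ added _ =
      subst (_< q) (sym (trans (row-grows added) (cong suc (empty-hits z)))) 1<q ,
      (other , trans (others-fixed added other other≢z) (empty-hits other)) ,
      mirror (record { centre = row-grows added ; reflected = reflected })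
             (other , other≢z , empty-hits other)
      where
      reflected : ∀ a → a ≢ z → hits A′ (π a) ≡ hits ⊥ a
      reflected a a≢z = trans (others-fixed added (π a) (π-avoids-z a≢z)) (trans (empty-hits (π a)) (sym (empty-hits a)))

parity : ∀ m → (∃ λ g → m ≡ g + g) ⊎ (∃ λ g → m ≡ suc (g + g))
parity zero = inj₁ (0 , refl)
parity (suc m) with parity m
... | inj₁ (g , refl) = inj₂ (g , refl)
... | inj₂ (g , refl) = inj₁ (suc g , cong suc (sym (+-suc g g)))

double-injective : ∀ m g → m + m ≡ g + g → m ≡ g
double-injective zero zero e = refl
double-injective (suc m) (suc g) e =
  cong suc (double-injective m g (suc-injective (trans (sym (+-suc m m)) (trans (suc-injective e) (+-suc g g)))))

2∣double : ∀ g → 2 ∣ g + g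
2∣double g = divides g (trans (cong (g +_) (sym (+-identityʳ g))) (*-comm 2 g))

module Reflection (g : ℕ) where

  g<2g+1 : g < suc (g + g)
  g<2g+1 = s≤s (m≤m+n g g)

  middle : Fin (suc (g + g))
  middle = fromℕ< g<2g+1

  opposite-middle : opposite middle ≡ middle
  opposite-middle = toℕ-injective (begin
    toℕ (opposite middle) ≡⟨ opposite-prop middle ⟩
    (g + g) ∸ toℕ middle  ≡⟨ cong ((g + g) ∸_) (toℕ-fromℕ< g<2g+1) ⟩
    (g + g) ∸ g           ≡⟨ m+n∸m≡n g g ⟩
    g                     ≡⟨ toℕ-fromℕ< g<2g+1 ⟨
    toℕ middle            ∎)
    where open ≡-Reasoning

  opposite-fixed⇒middle : ∀ a → opposite a ≡ a → a ≡ middle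
  opposite-fixed⇒middle a fixed = toℕ-injective (trans (double-injective (toℕ a) g twice) (sym (toℕ-fromℕ< g<2g+1)))
    where
    twice : toℕ a + toℕ a ≡ g + g
    twice = begin
      toℕ a + toℕ a               ≡⟨ cong (_+ toℕ a) (trans (sym (cong toℕ fixed)) (opposite-prop a)) ⟩
      (g + g) ∸ toℕ a + toℕ a     ≡⟨ m∸n+n≡m (≤-pred (toℕ<n a)) ⟩
      g + g                       ∎
      where open ≡-Reasoning

  zero≢middle : 1 < suc (g + g) → Fin.zero ≢ middle
  zero≢middle 1<2g+1 e = <-irrefl (trans (cong toℕ e) (toℕ-fromℕ< g<2g+1)) (g-pos g 1<2g+1)
    where
    g-pos : ∀ g → 1 < suc (g + g) → 0 < g
    g-pos zero (s≤s ())
    g-pos (suc g) _ = s≤s z≤n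

theorem6 : ∀ (n p q : ℕ) → 1 < p → 1 < q → n ≡ p * q → ¬ (2 ∣ n) →
    Σ (Lines n) λ L → IsTransitive L × PlayerIWin L
theorem6 n p q 1<p 1<q refl n-odd with parity p
... | inj₁ (g , refl) = ⊥-elim (n-odd (∣-trans (2∣double g) (m∣m*n q)))
... | inj₂ (g , refl) =
  Grid.lines p q , Grid.transitive p q ,
  Strategy.playerIWin opposite opposite-involutive middle opposite-middle opposite-fixed⇒middle
                      q-odd 1<q zero (zero≢middle 1<p)
  where
  open Reflection g
  q-odd : ∀ m → m + m ≢ q
  q-odd m e = n-odd (∣-trans (subst (2 ∣_) e (2∣double m)) (n∣m*n p))
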